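{- ${\sf S5}_n$ has the Agent Lyndon Interpolation Property: for all formulas $\phi,\psi$, if $\phi\to\psi\in{\sf S5}_n$, then there exists a formula $\delta$ such that $\phi\to\delta\in{\sf S5}_n$, $\delta\to\psi\in{\sf S5}_n$, $\mathrm{Var}^+(\delta)\subseteq\mathrm{Var}^+(\phi)\cap\mathrm{Var}^+(\psi)$, $\mathrm{Var}^-(\delta)\subseteq\mathrm{Var}^-(\phi)\cap\mathrm{Var}^-(\psi)$, and $\mathrm{Ag}(\delta)\subseteq\mathrm{Ag}(\phi)\cap\mathrm{Ag}(\psi)$.
   Context: Fix a countably infinite set $\mathrm{Prop}$ of atoms and a finite nonempty set $A$ of agents, $n=|A|$. Formulas (negation normal form): $\phi::=\bot\mid\top\mid p\mid\neg p\mid(\phi\wedge\phi)\mid(\phi\vee\phi)\mid\Box_a\phi\mid\Diamond_a\phi$. Negation of an arbitrary formula is defined by De Morgan dualities ($\neg\neg p=p$, $\neg\top=\bot$, $\neg(\phi\wedge\psi)=\neg\phi\vee\neg\psi$, $\neg\Box_a\phi=\Diamond_a\neg\phi$, and duals), and $\phi\to\psi:=\neg\phi\vee\psi$. $\mathrm{Var}^+(\phi)$ (resp. $\mathrm{Var}^-(\phi)$) is the set of atoms $p$ occurring in $\phi$ as the literal $p$ (resp. $\neg p$); $\mathrm{Ag}(\phi)$ is the set of agents $a$ such that $\Box_a$ or $\Diamond_a$ occurs in $\phi$. An epistemic model $\mathcal{M}=(W,R,V)$ has $W\ne\varnothing$, an equivalence relation $R_a$ on $W$ for each $a$, and $V:\mathrm{Prop}\to\mathcal{P}(W)$;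 truth is standard. ${\sf S5}_n$ is the set of formulas true at every world of every epistemic model. -}

module Defs where

open import Data.Nat using (ℕ; suc)
open import Data.Fin using (Fin)
open import Data.Product using (_×_; _,_; Σ)
open import Data.Sum using (_⊎_)
open import Data.Empty using (⊥)
open import Data.Unit using (⊤)
open import Relation.Binary.PropositionalEquality using (_≡_)
open import Relation.Binary.Structures using (IsEquivalence)
open import Level using (0ℓ)

-- Atoms: Prop = ℕ (countably infinite). Agents: A = Fin n.
-- Formulas in negation normal form over agents Fin n.
data Form (n : ℕ) : Set where
  ⊥' ⊤'   : Form n
  var     : ℕ → Form n
  nvar    : ℕ → Form n
  _∧'_    : Form n → Form n → Form n
  _∨'_    : Form n → Form n → Form n
  □       : Fin n → Form n → Form n
  ◇       : Fin n → Form n → Form n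

∼ : ∀ {n} → Form n → Form n
∼ ⊥' = ⊤'
∼ ⊤' = ⊥'
∼ (var p) = nvar p
∼ (nvar p) = var p
∼ (φ ∧' ψ) = ∼ φ ∨' ∼ ψ
∼ (φ ∨' ψ) = ∼ φ ∧' ∼ ψ
∼ (□ a φ) = ◇ a (∼ φ)
∼ (◇ a φ) = □ a (∼ φ)

_⇒_ : ∀ {n} → Form n → Form n → Form n
φ ⇒ ψ = ∼ φ ∨' ψ

data _∈Var⁺_ {n} (p : ℕ) : Form n → Set where
  here  : p ∈Var⁺ var p
  ∧ˡ : ∀ {φ ψ} → p ∈Var⁺ φ → p ∈Var⁺ (φ ∧' ψ)
  ∧ʳ : ∀ {φ ψ} → p ∈Var⁺ ψ → p ∈Var⁺ (φ ∧' ψ)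
  ∨ˡ : ∀ {φ ψ} → p ∈Var⁺ φ → p ∈Var⁺ (φ ∨' ψ)
  ∨ʳ : ∀ {φ ψ} → p ∈Var⁺ ψ → p ∈Var⁺ (φ ∨' ψ)
  in□ : ∀ {a φ} → p ∈Var⁺ φ → p ∈Var⁺ □ a φ
  in◇ : ∀ {a φ} → p ∈Var⁺ φ → p ∈Var⁺ ◇ a φ

data _∈Var⁻_ {n} (p : ℕ) : Form n → Set where
  here  : p ∈Var⁻ nvar p
  ∧ˡ : ∀ {φ ψ} → p ∈Var⁻ φ → p ∈Var⁻ (φ ∧' ψ)
  ∧ʳ : ∀ {φ ψ} → p ∈Var⁻ ψ → p ∈Var⁻ (φ ∧' ψ)
  ∨ˡ : ∀ {φ ψ} → p ∈Var⁻ φ → p ∈Var⁻ (φ ∨' ψ)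
  ∨ʳ : ∀ {φ ψ} → p ∈Var⁻ ψ → p ∈Var⁻ (φ ∨' ψ)
  in□ : ∀ {a φ} → p ∈Var⁻ φ → p ∈Var⁻ □ a φ
  in◇ : ∀ {a φ} → p ∈Var⁻ φ → p ∈Var⁻ ◇ a φ

data _∈Ag_ {n} (b : Fin n) : Form n → Set where
  here□ : ∀ {φ} → b ∈Ag □ b φ
  here◇ : ∀ {φ} → b ∈Ag ◇ b φ
  ∧ˡ : ∀ {φ ψ} → b ∈Ag φ → b ∈Ag (φ ∧' ψ)
  ∧ʳ : ∀ {φ ψ} → b ∈Ag ψ → b ∈Ag (φ ∧' ψ)
  ∨ˡ : ∀ {φ ψ} → b ∈Ag φ → b ∈Ag (φ ∨' ψ)
  ∨ʳ : ∀ {φ ψ} → b ∈Ag ψ → b ∈Ag (φ ∨' ψ)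
  in□ : ∀ {a φ} → b ∈Ag φ → b ∈Ag □ a φ
  in◇ : ∀ {a φ} → b ∈Ag φ → b ∈Ag ◇ a φ

record Model (n : ℕ) : Set₁ where
  field
    W     : Set
    w₀    : W
    R     : Fin n → W → W → Set
    R-eqv : (a : Fin n) → IsEquivalence (R a)
    V     : ℕ → W → Set

-- The meta-theory is constructive, so we use the
-- negative (Gödel–Gentzen) reading of ∨ and ◇, which coincides with
-- classical truth: A ∨ B := ¬(¬A ∧ ¬B), ◇φ := ¬ ∀ v. R w v → ¬ φ.
open Model

_,_⊨_ : ∀ {n} (M : Model n) → W M → Form n → Set
M , w ⊨ ⊥' = ⊥
M , w ⊨ ⊤' = ⊤
M , w ⊨ var p = (V M p w → ⊥) → ⊥
M , w ⊨ nvar p = V M p w → ⊥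
M , w ⊨ (φ ∧' ψ) = (M , w ⊨ φ) × (M , w ⊨ ψ)
M , w ⊨ (φ ∨' ψ) = ((M , w ⊨ φ) → ⊥) × ((M , w ⊨ ψ) → ⊥) → ⊥
M , w ⊨ □ a φ = ∀ v → R M a w v → M , v ⊨ φ
M , w ⊨ ◇ a φ = (∀ v → R M a w v → (M , v ⊨ φ) → ⊥) → ⊥

S5 : ∀ n → Form n → Set₁
S5 n φ = (M : Model n) (w : W M) → M , w ⊨ φ

-- The interpolant is a disjunction of characteristic formulas of finite bisimulation types.
-- Let d be the larger modal depth of φ and ψ. A depth-d type over the atoms of φ unravels into a
-- finite S5 structure on which φ can be evaluated, and a world realising the type satisfies φ iff
-- the root of that structure does. The characteristic formula χ of a type speaks only the shared
-- language: it keeps a literal only with a polarity it has in both φ and ψ, and a modality only for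
-- an agent occurring in both. The disjunction δ of χ over the types whose root satisfies φ follows
-- from φ, since every world realises some type. Conversely, if χ held at a world y of a model N
-- refuting ψ, we could glue the unravelled type and N at y into one tree model: a shared agent
-- moves on both sides at once (χ supplies matching successors), any other agent moves only on the
-- side whose formula mentions it. Both φ and ∼ψ survive at the root, contradicting φ → ψ.

module Submission where

open import Defs

open import Data.Empty using (⊥; ⊥-elim)
open import Data.Empty.Irrelevant using () renaming (⊥-elim to ⊥-elim-irr)
open import Data.Fin using (Fin; zero; suc; _≟_)
open import Data.List using (List; []; _∷_; map; _++_; filter; allFin; cartesianProductWith)
open import Data.List.Membership.Propositional using (_∈_; mapWith∈; find; lose)
open import Data.List.Membership.Propositional.Properties
  using (∈-++⁺ˡ; ∈-++⁺ʳ; ∈-map⁺; ∈-filter⁺; ∈-filter⁻; ∈-allFin; ∈-cartesianProductWith⁺)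
open import Data.List.Relation.Unary.All as All using (All; []; _∷_)
open import Data.List.Relation.Unary.All.Properties as All using ()
open import Data.List.Relation.Unary.Any as Any using (Any; here; there)
open import Data.List.Relation.Unary.Any.Properties as Any using (mapWith∈⁺; mapWith∈⁻)
open import Data.Nat using (ℕ; zero; suc; _⊔_; _≤_; z≤n; s≤s)
open import Data.Nat.Properties
  using (≤-refl; ≤-reflexive; ≤-trans; ≤-pred; n≤1+n; m⊔n≤o⇒m≤o; m⊔n≤o⇒n≤o; m≤m⊔n; m≤n⊔m)
  renaming (_≟_ to _≟ℕ_)
open import Data.List.Membership.DecPropositional _≟ℕ_ using (_∈?_)
open import Data.Product using (Σ; ∃-syntax; _×_; _,_; proj₁; proj₂)
open import Data.Product.Function.NonDependent.Propositional using (_×-⇔_)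
open import Data.Sum using (_⊎_; inj₁; inj₂; [_,_])
open import Data.Unit using (tt) renaming (⊤ to Unit)
open import Data.Vec using (Vec; lookup) renaming ([] to []ᵥ; _∷_ to _∷ᵥ_)
open import Effect.Monad using (RawMonad)
open import Function.Base using (_on_)
open import Function.Bundles using (_⇔_; mk⇔; module Equivalence)
open import Level using (0ℓ)
open import Relation.Binary.Construct.On as On using ()
open import Relation.Binary.PropositionalEquality
  using (_≡_; refl; sym; cong; cong₂; subst; isEquivalence)
open import Relation.Binary.Structures using (IsEquivalence)
open import Relation.Nullary using (¬_; Dec; yes; no; ¬?; _×-dec_; _⊎-dec_)
open import Relation.Nullary.Decidable as Dec using (¬¬-excluded-middle; decidable-stable)
open import Relation.Nullary.Negation using (¬¬-Monad; ¬¬-map; Stable)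
open import Relation.Unary using (Decidable)

open Model
open Equivalence using (to; from)
open RawMonad (¬¬-Monad {0ℓ}) using (_>>=_; pure)

private variable
  n : ℕ

depth : Form n → ℕ
depth ⊥' = 0
depth ⊤' = 0
depth (var _) = 0
depth (nvar _) = 0
depth (θ ∧' θ′) = depth θ ⊔ depth θ′
depth (θ ∨' θ′) = depth θ ⊔ depth θ′
depth (□ _ θ) = suc (depth θ)
depth (◇ _ θ) = suc (depth θ)

depth-∼ : (θ : Form n) → depth (∼ θ) ≡ depth θ
depth-∼ ⊥' = refl
depth-∼ ⊤' = refl
depth-∼ (var _) = refl
depth-∼ (nvar _) = refl
depth-∼ (θ ∧' θ′) = cong₂ _⊔_ (depth-∼ θ) (depth-∼ θ′)
depth-∼ (θ ∨' θ′) = cong₂ _⊔_ (depth-∼ θ) (depth-∼ θ′)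
depth-∼ (□ _ θ) = cong suc (depth-∼ θ)
depth-∼ (◇ _ θ) = cong suc (depth-∼ θ)

⋀ : List (Form n) → Form n
⋀ [] = ⊤'
⋀ (θ ∷ θs) = θ ∧' ⋀ θs

⋁ : List (Form n) → Form n
⋁ [] = ⊥'
⋁ (θ ∷ θs) = θ ∨' ⋁ θs

record Lang (n : ℕ) : Set₁ where
  field
    Var⁺ Var⁻ : ℕ → Set
    Ag : Fin n → Set

open Lang

record _⊑_ {n : ℕ} (θ : Form n) (L : Lang n) : Set where
  field
    var⁺ : ∀ {p} → p ∈Var⁺ θ → Var⁺ L p
    var⁻ : ∀ {p} → p ∈Var⁻ θ → Var⁻ L p
    ag : ∀ {a} → a ∈Ag θ → Ag L a

open _⊑_

lang : Form n → Lang n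
lang θ = record { Var⁺ = _∈Var⁺ θ ; Var⁻ = _∈Var⁻ θ ; Ag = _∈Ag θ }

_∩_ : Lang n → Lang n → Lang n
L ∩ L′ = record
  { Var⁺ = λ p → Var⁺ L p × Var⁺ L′ p
  ; Var⁻ = λ p → Var⁻ L p × Var⁻ L′ p
  ; Ag = λ a → Ag L a × Ag L′ a
  }

dual : Lang n → Lang n
dual L = record { Var⁺ = Var⁻ L ; Var⁻ = Var⁺ L ; Ag = Ag L }

atomsIn : List ℕ → Lang n
atomsIn P = record { Var⁺ = _∈ P ; Var⁻ = _∈ P ; Ag = λ _ → Unit }

⊑-lang : (θ : Form n) → θ ⊑ lang θ
⊑-lang θ = record { var⁺ = λ i → i ; var⁻ = λ i → i ; ag = λ i → i }

module _ {n : ℕ} {L : Lang n} where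

  ⊑-⊤ : ⊤' ⊑ L
  ⊑-⊤ = record { var⁺ = λ () ; var⁻ = λ () ; ag = λ () }

  ⊑-var : ∀ {p} → Var⁺ L p → var p ⊑ L
  ⊑-var v = record { var⁺ = λ { here → v } ; var⁻ = λ () ; ag = λ () }

  ⊑-nvar : ∀ {p} → Var⁻ L p → nvar p ⊑ L
  ⊑-nvar v = record { var⁺ = λ () ; var⁻ = λ { here → v } ; ag = λ () }

  ⊑-∧ : {θ θ′ : Form n} → θ ⊑ L → θ′ ⊑ L → (θ ∧' θ′) ⊑ L
  ⊑-∧ t t′ = record
    { var⁺ = λ { (∧ˡ i) → var⁺ t i ; (∧ʳ i) → var⁺ t′ i }
    ; var⁻ = λ { (∧ˡ i) → var⁻ t i ; (∧ʳ i) → var⁻ t′ i }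
    ; ag = λ { (∧ˡ i) → ag t i ; (∧ʳ i) → ag t′ i }
    }

  ⊑-∨ : {θ θ′ : Form n} → θ ⊑ L → θ′ ⊑ L → (θ ∨' θ′) ⊑ L
  ⊑-∨ t t′ = record
    { var⁺ = λ { (∨ˡ i) → var⁺ t i ; (∨ʳ i) → var⁺ t′ i }
    ; var⁻ = λ { (∨ˡ i) → var⁻ t i ; (∨ʳ i) → var⁻ t′ i }
    ; ag = λ { (∨ˡ i) → ag t i ; (∨ʳ i) → ag t′ i }
    }

  ⊑-□ : ∀ {a} {θ : Form n} → Ag L a → θ ⊑ L → □ a θ ⊑ L
  ⊑-□ a t = record
    { var⁺ = λ { (in□ i) → var⁺ t i }
    ; var⁻ = λ { (in□ i) → var⁻ t i }
    ; ag = λ { here□ → a ; (in□ i) → ag t i }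
    }

  ⊑-◇ : ∀ {a} {θ : Form n} → Ag L a → θ ⊑ L → ◇ a θ ⊑ L
  ⊑-◇ a t = record
    { var⁺ = λ { (in◇ i) → var⁺ t i }
    ; var⁻ = λ { (in◇ i) → var⁻ t i }
    ; ag = λ { here◇ → a ; (in◇ i) → ag t i }
    }

  ⊑-⋀ : {θs : List (Form n)} → All (_⊑ L) θs → ⋀ θs ⊑ L
  ⊑-⋀ [] = ⊑-⊤
  ⊑-⋀ (t ∷ ts) = ⊑-∧ t (⊑-⋀ ts)

  ⊑-⋁ : {θs : List (Form n)} → All (_⊑ L) θs → ⋁ θs ⊑ L
  ⊑-⋁ [] = record { var⁺ = λ () ; var⁻ = λ () ; ag = λ () }
  ⊑-⋁ (t ∷ ts) = ⊑-∨ t (⊑-⋁ ts)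

  ⊑-sub : {θ θ′ : Form n} →
          (∀ {p} → p ∈Var⁺ θ → p ∈Var⁺ θ′) → (∀ {p} → p ∈Var⁻ θ → p ∈Var⁻ θ′) →
          (∀ {a} → a ∈Ag θ → a ∈Ag θ′) → θ′ ⊑ L → θ ⊑ L
  ⊑-sub f g h t = record { var⁺ = λ i → var⁺ t (f i) ; var⁻ = λ i → var⁻ t (g i) ; ag = λ i → ag t (h i) }

  ∧-⊑ : {θ θ′ : Form n} → (θ ∧' θ′) ⊑ L → θ ⊑ L × θ′ ⊑ L
  ∧-⊑ t = ⊑-sub ∧ˡ ∧ˡ ∧ˡ t , ⊑-sub ∧ʳ ∧ʳ ∧ʳ t

  ∨-⊑ : {θ θ′ : Form n} → (θ ∨' θ′) ⊑ L → θ ⊑ L × θ′ ⊑ L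
  ∨-⊑ t = ⊑-sub ∨ˡ ∨ˡ ∨ˡ t , ⊑-sub ∨ʳ ∨ʳ ∨ʳ t

  □-⊑ : ∀ {a} {θ : Form n} → □ a θ ⊑ L → Ag L a × θ ⊑ L
  □-⊑ t = ag t here□ , ⊑-sub in□ in□ in□ t

  ◇-⊑ : ∀ {a} {θ : Form n} → ◇ a θ ⊑ L → Ag L a × θ ⊑ L
  ◇-⊑ t = ag t here◇ , ⊑-sub in◇ in◇ in◇ t

∼-⊑-dual : (θ : Form n) → ∼ θ ⊑ dual (lang θ)
∼-⊑-dual θ = record { var⁺ = flip⁺ θ ; var⁻ = flip⁻ θ ; ag = agents θ }
  where
  flip⁺ : ∀ {n p} (θ : Form n) → p ∈Var⁺ ∼ θ → p ∈Var⁻ θ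
  flip⁻ : ∀ {n p} (θ : Form n) → p ∈Var⁻ ∼ θ → p ∈Var⁺ θ
  flip⁺ (nvar p) here = here
  flip⁺ (θ ∧' θ′) (∨ˡ i) = ∧ˡ (flip⁺ θ i)
  flip⁺ (θ ∧' θ′) (∨ʳ i) = ∧ʳ (flip⁺ θ′ i)
  flip⁺ (θ ∨' θ′) (∧ˡ i) = ∨ˡ (flip⁺ θ i)
  flip⁺ (θ ∨' θ′) (∧ʳ i) = ∨ʳ (flip⁺ θ′ i)
  flip⁺ (□ _ θ) (in◇ i) = in□ (flip⁺ θ i)
  flip⁺ (◇ _ θ) (in□ i) = in◇ (flip⁺ θ i)
  flip⁻ (var p) here = here
  flip⁻ (θ ∧' θ′) (∨ˡ i) = ∧ˡ (flip⁻ θ i)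
  flip⁻ (θ ∧' θ′) (∨ʳ i) = ∧ʳ (flip⁻ θ′ i)
  flip⁻ (θ ∨' θ′) (∧ˡ i) = ∨ˡ (flip⁻ θ i)
  flip⁻ (θ ∨' θ′) (∧ʳ i) = ∨ʳ (flip⁻ θ′ i)
  flip⁻ (□ _ θ) (in◇ i) = in□ (flip⁻ θ i)
  flip⁻ (◇ _ θ) (in□ i) = in◇ (flip⁻ θ i)
  agents : ∀ {n a} (θ : Form n) → a ∈Ag ∼ θ → a ∈Ag θ
  agents (θ ∧' θ′) (∨ˡ i) = ∧ˡ (agents θ i)
  agents (θ ∧' θ′) (∨ʳ i) = ∧ʳ (agents θ′ i)
  agents (θ ∨' θ′) (∧ˡ i) = ∨ˡ (agents θ i)
  agents (θ ∨' θ′) (∧ʳ i) = ∨ʳ (agents θ′ i)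
  agents (□ _ θ) here◇ = here□
  agents (□ _ θ) (in◇ i) = in□ (agents θ i)
  agents (◇ _ θ) here□ = here◇
  agents (◇ _ θ) (in□ i) = in◇ (agents θ i)

atoms : Form n → List ℕ
atoms ⊥' = []
atoms ⊤' = []
atoms (var p) = p ∷ []
atoms (nvar p) = p ∷ []
atoms (θ ∧' θ′) = atoms θ ++ atoms θ′
atoms (θ ∨' θ′) = atoms θ ++ atoms θ′
atoms (□ _ θ) = atoms θ
atoms (◇ _ θ) = atoms θ

⊑-atoms : (θ : Form n) → θ ⊑ atomsIn (atoms θ)
⊑-atoms θ = record { var⁺ = pos θ ; var⁻ = neg θ ; ag = λ _ → tt }
  where
  pos : ∀ {n p} (θ : Form n) → p ∈Var⁺ θ → p ∈ atoms θ
  pos (var p) here = here refl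
  pos (θ ∧' θ′) (∧ˡ i) = ∈-++⁺ˡ (pos θ i)
  pos (θ ∧' θ′) (∧ʳ i) = ∈-++⁺ʳ (atoms θ) (pos θ′ i)
  pos (θ ∨' θ′) (∨ˡ i) = ∈-++⁺ˡ (pos θ i)
  pos (θ ∨' θ′) (∨ʳ i) = ∈-++⁺ʳ (atoms θ) (pos θ′ i)
  pos (□ _ θ) (in□ i) = pos θ i
  pos (◇ _ θ) (in◇ i) = pos θ i
  neg : ∀ {n p} (θ : Form n) → p ∈Var⁻ θ → p ∈ atoms θ
  neg (nvar p) here = here refl
  neg (θ ∧' θ′) (∧ˡ i) = ∈-++⁺ˡ (neg θ i)
  neg (θ ∧' θ′) (∧ʳ i) = ∈-++⁺ʳ (atoms θ) (neg θ′ i)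
  neg (θ ∨' θ′) (∨ˡ i) = ∈-++⁺ˡ (neg θ i)
  neg (θ ∨' θ′) (∨ʳ i) = ∈-++⁺ʳ (atoms θ) (neg θ′ i)
  neg (□ _ θ) (in□ i) = neg θ i
  neg (◇ _ θ) (in◇ i) = neg θ i

∈Var⁺? : ∀ p (θ : Form n) → Dec (p ∈Var⁺ θ)
∈Var⁺? p ⊥' = no λ ()
∈Var⁺? p ⊤' = no λ ()
∈Var⁺? p (var q) = Dec.map′ (λ { refl → here }) (λ { here → refl }) (p ≟ℕ q)
∈Var⁺? p (nvar q) = no λ ()
∈Var⁺? p (θ ∧' θ′) =
  Dec.map′ [ ∧ˡ , ∧ʳ ] (λ { (∧ˡ i) → inj₁ i ; (∧ʳ i) → inj₂ i }) (∈Var⁺? p θ ⊎-dec ∈Var⁺? p θ′)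
∈Var⁺? p (θ ∨' θ′) =
  Dec.map′ [ ∨ˡ , ∨ʳ ] (λ { (∨ˡ i) → inj₁ i ; (∨ʳ i) → inj₂ i }) (∈Var⁺? p θ ⊎-dec ∈Var⁺? p θ′)
∈Var⁺? p (□ a θ) = Dec.map′ in□ (λ { (in□ i) → i }) (∈Var⁺? p θ)
∈Var⁺? p (◇ a θ) = Dec.map′ in◇ (λ { (in◇ i) → i }) (∈Var⁺? p θ)

∈Var⁻? : ∀ p (θ : Form n) → Dec (p ∈Var⁻ θ)
∈Var⁻? p ⊥' = no λ ()
∈Var⁻? p ⊤' = no λ ()
∈Var⁻? p (var q) = no λ ()
∈Var⁻? p (nvar q) = Dec.map′ (λ { refl → here }) (λ { here → refl }) (p ≟ℕ q)
∈Var⁻? p (θ ∧' θ′) =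
  Dec.map′ [ ∧ˡ , ∧ʳ ] (λ { (∧ˡ i) → inj₁ i ; (∧ʳ i) → inj₂ i }) (∈Var⁻? p θ ⊎-dec ∈Var⁻? p θ′)
∈Var⁻? p (θ ∨' θ′) =
  Dec.map′ [ ∨ˡ , ∨ʳ ] (λ { (∨ˡ i) → inj₁ i ; (∨ʳ i) → inj₂ i }) (∈Var⁻? p θ ⊎-dec ∈Var⁻? p θ′)
∈Var⁻? p (□ a θ) = Dec.map′ in□ (λ { (in□ i) → i }) (∈Var⁻? p θ)
∈Var⁻? p (◇ a θ) = Dec.map′ in◇ (λ { (in◇ i) → i }) (∈Var⁻? p θ)

∈Ag? : ∀ a (θ : Form n) → Dec (a ∈Ag θ)
∈Ag? a ⊥' = no λ ()
∈Ag? a ⊤' = no λ ()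
∈Ag? a (var q) = no λ ()
∈Ag? a (nvar q) = no λ ()
∈Ag? a (θ ∧' θ′) = Dec.map′ [ ∧ˡ , ∧ʳ ] (λ { (∧ˡ i) → inj₁ i ; (∧ʳ i) → inj₂ i }) (∈Ag? a θ ⊎-dec ∈Ag? a θ′)
∈Ag? a (θ ∨' θ′) = Dec.map′ [ ∨ˡ , ∨ʳ ] (λ { (∨ˡ i) → inj₁ i ; (∨ʳ i) → inj₂ i }) (∈Ag? a θ ⊎-dec ∈Ag? a θ′)
∈Ag? a (□ b θ) = Dec.map′ [ (λ { refl → here□ }) , in□ ] (λ { here□ → inj₁ refl ; (in□ i) → inj₂ i })
                          (a ≟ b ⊎-dec ∈Ag? a θ)
∈Ag? a (◇ b θ) = Dec.map′ [ (λ { refl → here◇ }) , in◇ ] (λ { here◇ → inj₁ refl ; (in◇ i) → inj₂ i })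
                          (a ≟ b ⊎-dec ∈Ag? a θ)

record Decides (L : Lang n) : Set where
  field
    var⁺? : Decidable (Var⁺ L)
    var⁻? : Decidable (Var⁻ L)
    ag? : Decidable (Ag L)

lang? : (θ : Form n) → Decides (lang θ)
lang? θ = record { var⁺? = λ p → ∈Var⁺? p θ ; var⁻? = λ p → ∈Var⁻? p θ ; ag? = λ a → ∈Ag? a θ }

_∩?_ : {L L′ : Lang n} → Decides L → Decides L′ → Decides (L ∩ L′)
L? ∩? L′? = record
  { var⁺? = λ p → var⁺? L? p ×-dec var⁺? L′? p
  ; var⁻? = λ p → var⁻? L? p ×-dec var⁻? L′? p
  ; ag? = λ a → ag? L? a ×-dec ag? L′? a
  }
  where open Decides

module Semantics {n : ℕ} (M : Model n) where

  R-refl : ∀ a {x} → R M a x x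
  R-refl a = IsEquivalence.refl (R-eqv M a)

  R-sym : ∀ a {x y} → R M a x y → R M a y x
  R-sym a = IsEquivalence.sym (R-eqv M a)

  R-trans : ∀ a {x y z} → R M a x y → R M a y z → R M a x z
  R-trans a = IsEquivalence.trans (R-eqv M a)

  ⊨-stable : ∀ θ {w} → Stable (M , w ⊨ θ)
  ⊨-stable ⊥' h = h λ ()
  ⊨-stable ⊤' h = tt
  ⊨-stable (var p) h ¬v = h λ k → k ¬v
  ⊨-stable (nvar p) h v = h λ k → k v
  ⊨-stable (θ ∧' θ′) h = ⊨-stable θ (λ k → h λ (x , _) → k x) , ⊨-stable θ′ (λ k → h λ (_ , y) → k y)
  ⊨-stable (θ ∨' θ′) h k = h λ z → z k
  ⊨-stable (□ a θ) h v r = ⊨-stable θ λ k → h λ f → k (f v r)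
  ⊨-stable (◇ a θ) h k = h λ z → z k

  ∼-refutes : ∀ θ {w} → M , w ⊨ ∼ θ → ¬ (M , w ⊨ θ)
  ∼-refutes ⊥' _ ()
  ∼-refutes ⊤' ()
  ∼-refutes (var p) ¬v ¬¬v = ¬¬v ¬v
  ∼-refutes (nvar p) ¬¬v ¬v = ¬¬v ¬v
  ∼-refutes (θ ∧' θ′) h (x , y) = h ((λ z → ∼-refutes θ z x) , (λ z → ∼-refutes θ′ z y))
  ∼-refutes (θ ∨' θ′) (x , y) h = h (∼-refutes θ x , ∼-refutes θ′ y)
  ∼-refutes (□ a θ) h box = h λ v r z → ∼-refutes θ z (box v r)
  ∼-refutes (◇ a θ) box h = h λ v r → ∼-refutes θ (box v r)

  ∼-intro : ∀ θ {w} → ¬ (M , w ⊨ θ) → M , w ⊨ ∼ θ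
  ∼-intro ⊥' h = tt
  ∼-intro ⊤' h = h tt
  ∼-intro (var p) h v = h λ ¬v → ¬v v
  ∼-intro (nvar p) h = h
  ∼-intro (θ ∧' θ′) h (¬x , ¬y) =
    h (⊨-stable θ (λ ¬z → ¬x (∼-intro θ ¬z)) , ⊨-stable θ′ (λ ¬z → ¬y (∼-intro θ′ ¬z)))
  ∼-intro (θ ∨' θ′) h = ∼-intro θ (λ x → h λ (¬x , _) → ¬x x) , ∼-intro θ′ (λ y → h λ (_ , ¬y) → ¬y y)
  ∼-intro (□ a θ) h k = h λ v r → ⊨-stable θ λ ¬z → k v r (∼-intro θ ¬z)
  ∼-intro (◇ a θ) h v r = ∼-intro θ λ z → h λ k → k v r z

  ¬∼-elim : ∀ θ {w} → ¬ (M , w ⊨ ∼ θ) → M , w ⊨ θ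
  ¬∼-elim θ h = ⊨-stable θ λ ¬z → h (∼-intro θ ¬z)

  ⋀⁺ : ∀ {w θs} → All (λ θ → M , w ⊨ θ) θs → M , w ⊨ ⋀ θs
  ⋀⁺ [] = tt
  ⋀⁺ (h ∷ hs) = h , ⋀⁺ hs

  ⋀⁻ : ∀ {w} θs → M , w ⊨ ⋀ θs → All (λ θ → M , w ⊨ θ) θs
  ⋀⁻ [] _ = []
  ⋀⁻ (θ ∷ θs) (h , hs) = h ∷ ⋀⁻ θs hs

  ⋁⁺ : ∀ {w θs} → Any (λ θ → M , w ⊨ θ) θs → M , w ⊨ ⋁ θs
  ⋁⁺ (here h) (¬h , _) = ¬h h
  ⋁⁺ (there h) (_ , ¬h) = ¬h (⋁⁺ h)

  ◇⁻ : ∀ {a θ w} → M , w ⊨ ◇ a θ → ¬ ¬ (∃[ v ] R M a w v × M , v ⊨ θ)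
  ◇⁻ h k = h λ v r z → k (v , r , z)

  ⋁⁻ : ∀ {w} θs → M , w ⊨ ⋁ θs → ¬ ¬ Any (λ θ → M , w ⊨ θ) θs
  ⋁⁻ [] ()
  ⋁⁻ (θ ∷ θs) h k = h ((λ z → k (here z)) , λ z → ⋁⁻ θs z λ z′ → k (there z′))

⇒-valid : {φ ψ : Form n} → (∀ M w → M , w ⊨ φ → ¬ ¬ (M , w ⊨ ψ)) → S5 n (φ ⇒ ψ)
⇒-valid {φ = φ} h M w (¬∼φ , ¬ψ) = h M w (¬∼-elim φ ¬∼φ) ¬ψ
  where open Semantics M

⇒-refutes : {φ ψ : Form n} → S5 n (φ ⇒ ψ) → ∀ M w → M , w ⊨ φ → ¬ (M , w ⊨ ∼ ψ)
⇒-refutes {φ = φ} {ψ} valid M w hφ h∼ψ = valid M w ((λ h∼φ → ∼-refutes φ h∼φ hφ) , ∼-refutes ψ h∼ψ)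
  where open Semantics M

module _ {A : Set} where

  subsets : List A → List (List A)
  subsets [] = [] ∷ []
  subsets (x ∷ xs) = map (x ∷_) (subsets xs) ++ subsets xs

  record Selects (Q : A → Set) (L S : List A) : Set where
    field
      sound : ∀ {a} → a ∈ S → Q a
      complete : ∀ {a} → a ∈ L → Q a → a ∈ S

  open Selects public

  ¬¬-select : (Q : A → Set) (L : List A) → ¬ ¬ (∃[ S ] S ∈ subsets L × Selects Q L S)
  ¬¬-select Q [] = pure ([] , here refl , record { sound = λ () ; complete = λ () })
  ¬¬-select Q (x ∷ L) = do
    (S , S∈ , sel) ← ¬¬-select Q L
    yes q ← ¬¬-excluded-middle
      where no ¬q → pure (S , ∈-++⁺ʳ (map (x ∷_) (subsets L)) S∈ , record
              { sound = sound sel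
              ; complete = λ { (here refl) q → ⊥-elim (¬q q) ; (there a∈) → complete sel a∈ } })
    pure (x ∷ S , ∈-++⁺ˡ (∈-map⁺ (x ∷_) S∈) , record
      { sound = λ { (here refl) → q ; (there a∈) → sound sel a∈ }
      ; complete = λ { (here refl) _ → here refl ; (there a∈) qa → there (complete sel a∈ qa) } })

  vectors : List A → (k : ℕ) → List (Vec A k)
  vectors xs zero = []ᵥ ∷ []
  vectors xs (suc k) = cartesianProductWith _∷ᵥ_ xs (vectors xs k)

  ¬¬-choose : (xs : List A) (k : ℕ) (F : Fin k → A → Set) →
              (∀ i → ¬ ¬ (∃[ a ] a ∈ xs × F i a)) →
              ¬ ¬ (∃[ v ] v ∈ vectors xs k × ∀ i → F i (lookup v i))
  ¬¬-choose xs zero F h = pure ([]ᵥ , here refl , λ ())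
  ¬¬-choose xs (suc k) F h = do
    (a , a∈ , Fa) ← h zero
    (v , v∈ , Fv) ← ¬¬-choose xs k (λ i → F (suc i)) (λ i → h (suc i))
    pure (a ∷ᵥ v , ∈-cartesianProductWith⁺ _∷ᵥ_ a∈ v∈ , λ { zero → Fa ; (suc i) → Fv i })

-- A valuation lists the atoms of P that are true.
module Types (n : ℕ) (P : List ℕ) where

  Valuation : Set
  Valuation = List ℕ

  Ty : ℕ → Set
  Ty zero = Valuation
  Ty (suc k) = Valuation × Vec (List (Ty k)) n

  valuation : ∀ {k} → Ty k → Valuation
  valuation {zero} c = c
  valuation {suc k} (c , _) = c

  successors : ∀ {k} → Ty (suc k) → Fin n → List (Ty k)
  successors (_ , S) = lookup S

  types : (k : ℕ) → List (Ty k)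
  types zero = subsets P
  types (suc k) = cartesianProductWith _,_ (subsets P) (vectors (subsets (types k)) n)

  module Realisation (M : Model n) where

    ValuationAt : W M → Valuation → Set
    ValuationAt x = Selects (λ p → ¬ ¬ V M p x) P

    Realises : ∀ k → W M → Ty k → Set
    Realises zero x c = ValuationAt x c
    Realises (suc k) x (c , S) =
      ValuationAt x c ×
      ∀ a → Selects (λ U → ¬ ¬ (∃[ x′ ] R M a x x′ × Realises k x′ U)) (types k) (lookup S a)

    valuation-realised : ∀ k {x} U → Realises k x U → ValuationAt x (valuation U)
    valuation-realised zero U r = r
    valuation-realised (suc k) U (r , _) = r

    realise : ∀ k x → ¬ ¬ (∃[ U ] U ∈ types k × Realises k x U)
    realise zero x = ¬¬-select _ P
    realise (suc k) x = do
      (c , c∈ , rc) ← ¬¬-select _ P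
      (S , S∈ , rS) ← ¬¬-choose (subsets (types k)) n (λ a → Selects (Succ a) (types k))
                                 (λ a → ¬¬-select (Succ a) (types k))
      pure ((c , S) , ∈-cartesianProductWith⁺ _,_ c∈ S∈ , rc , rS)
      where
      Succ : Fin n → Ty k → Set
      Succ a U = ¬ ¬ (∃[ x′ ] R M a x x′ × Realises k x′ U)

    realises-forth : ∀ {k x} U a → Realises (suc k) x U → ∀ {x′} → R M a x x′ →
                     ¬ ¬ (∃[ U′ ] U′ ∈ successors U a × Realises k x′ U′)
    realises-forth {k} U a (_ , rS) {x′} r = do
      (U′ , U′∈ , rU′) ← realise k x′
      pure (U′ , complete (rS a) U′∈ (pure (x′ , r , rU′)) , rU′)

    realises-back : ∀ {k x} U a → Realises (suc k) x U → ∀ {U′} → U′ ∈ successors U a →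
                    ¬ ¬ (∃[ x′ ] R M a x x′ × Realises k x′ U′)
    realises-back U a (_ , rS) = sound (rS a)

  module Unravelling {d : ℕ} (T₀ : Ty d) where

    -- A path never follows the same agent twice in a row: the a-successors of a position reached
    -- by a are its a-siblings. The a-class of a position is thus its a-parent, or itself when it was
    -- not reached by a, together with that position's a-children. Freshness is irrelevant so that a
    -- position is determined by its moves alone.
    data Path : (k : ℕ) → Ty k → Set
    Fresh : ∀ {k U} → Fin n → Path k U → Set

    data Path where
      root : Path d T₀
      step : ∀ {k U U′} (π : Path (suc k) U) (a : Fin n) → U′ ∈ successors U a → .(Fresh a π) → Path k U′

    Fresh a root = Unit
    Fresh a (step _ b _ _) = ¬ b ≡ a

    fresh? : ∀ {k U} a (π : Path k U) → Dec (Fresh a π)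
    fresh? a root = yes tt
    fresh? a (step _ b _ _) = ¬? (b ≟ a)

    fresh-recover : ∀ {k U a} (π : Path k U) → .(Fresh a π) → Fresh a π
    fresh-recover root _ = tt
    fresh-recover (step _ _ _ _) f e = ⊥-elim-irr (f e)

    Pos : Set
    Pos = Σ ℕ λ k → Σ (Ty k) (Path k)

    top : Pos
    top = d , T₀ , root

    level : Pos → ℕ
    level = proj₁

    valuationAt : Pos → Valuation
    valuationAt (_ , U , _) = valuation U

    FreshPos : Fin n → Pos → Set
    FreshPos a (_ , _ , π) = Fresh a π

    rep : Fin n → Pos → Pos
    rep a (k , U , root) = k , U , root
    rep a (k , U , step {U = U₀} π b m f) with b ≟ a
    ... | yes _ = suc k , U₀ , π
    ... | no _ = k , U , step π b m f

    children : Fin n → Pos → List Pos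
    children a (zero , _ , _) = []
    children a (suc k , U , π) with fresh? a π
    ... | yes f = mapWith∈ (successors U a) (λ m → k , _ , step π a m f)
    ... | no _ = []

    members : Fin n → Pos → List Pos
    members a r = r ∷ children a r

    class : Fin n → Pos → List Pos
    class a s = members a (rep a s)

    child∈children : ∀ {k U U′} a (π : Path (suc k) U) (m : U′ ∈ successors U a) (f : Fresh a π) →
                     (k , U′ , step π a m f) ∈ children a (suc k , U , π)
    child∈children a π m f with fresh? a π
    ... | yes _ = mapWith∈⁺ _ (_ , m , refl)
    ... | no ¬f = ⊥-elim (¬f f)

    children-view : ∀ {k U s′} a (π : Path (suc k) U) → s′ ∈ children a (suc k , U , π) →
                    ∃[ U′ ] Σ (U′ ∈ successors U a) λ m → Σ (Fresh a π) λ f → s′ ≡ (k , U′ , step π a m f)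
    children-view {U = U} a π s′∈ with fresh? a π
    ... | yes f = let (U′ , m , e) = mapWith∈⁻ (successors U a) _ s′∈ in U′ , m , f , e

    rep-fresh : ∀ a s → FreshPos a (rep a s)
    rep-fresh a (k , U , root) = tt
    rep-fresh a (k , U , step π b m f) with b ≟ a
    ... | yes refl = fresh-recover π f
    ... | no b≢a = b≢a

    rep-of-fresh : ∀ a s → FreshPos a s → rep a s ≡ s
    rep-of-fresh a (k , U , root) _ = refl
    rep-of-fresh a (k , U , step π b m f) b≢a with b ≟ a
    ... | yes b≡a = ⊥-elim (b≢a b≡a)
    ... | no _ = refl

    rep-of-child : ∀ {k U U′} a (π : Path (suc k) U) (m : U′ ∈ successors U a) .(f : Fresh a π) →
                   rep a (k , U′ , step π a m f) ≡ (suc k , U , π)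
    rep-of-child a π m f with a ≟ a
    ... | yes _ = refl
    ... | no a≢a = ⊥-elim (a≢a refl)

    rep-of-member : ∀ a r → FreshPos a r → ∀ {s′} → s′ ∈ members a r → rep a s′ ≡ r
    rep-of-member a r f (here refl) = rep-of-fresh a r f
    rep-of-member a (suc k , U , π) _ (there s′∈) with children-view a π s′∈
    ... | U′ , m , f , refl = rep-of-child a π m f

    class-of-member : ∀ a s {s′} → s′ ∈ class a s → class a s′ ≡ class a s
    class-of-member a s s′∈ = cong (members a) (rep-of-member a (rep a s) (rep-fresh a s) s′∈)

    ∈-class : ∀ a s → s ∈ class a s
    ∈-class a (k , U , root) = here refl
    ∈-class a (k , U , step π b m f) with b ≟ a
    ... | yes refl = there (child∈children b π m (fresh-recover π f))
    ... | no _ = here refl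

    level-rep : ∀ a s → level s ≤ level (rep a s)
    level-rep a (k , U , root) = ≤-refl
    level-rep a (k , U , step π b m f) with b ≟ a
    ... | yes _ = n≤1+n k
    ... | no _ = ≤-refl

    level-member : ∀ a r {s′} → s′ ∈ members a r → level r ≤ suc (level s′)
    level-member a r (here refl) = n≤1+n (level r)
    level-member a (suc k , U , π) (there s′∈) with children-view a π s′∈
    ... | _ , _ , _ , refl = ≤-refl

    level-in-class : ∀ {m} a s {s′} → suc m ≤ level s → s′ ∈ class a s → m ≤ level s′
    level-in-class a s lt s′∈ = ≤-pred (≤-trans lt (≤-trans (level-rep a s) (level-member a (rep a s) s′∈)))

    Sat : Pos → Form n → Set
    Sat s ⊥' = ⊥
    Sat s ⊤' = Unit
    Sat s (var p) = p ∈ valuationAt s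
    Sat s (nvar p) = ¬ p ∈ valuationAt s
    Sat s (θ ∧' θ′) = Sat s θ × Sat s θ′
    Sat s (θ ∨' θ′) = Sat s θ ⊎ Sat s θ′
    Sat s (□ a θ) = All (λ s′ → Sat s′ θ) (class a s)
    Sat s (◇ a θ) = Any (λ s′ → Sat s′ θ) (class a s)

    sat? : ∀ s θ → Dec (Sat s θ)
    sat? s ⊥' = no λ ()
    sat? s ⊤' = yes tt
    sat? s (var p) = p ∈? valuationAt s
    sat? s (nvar p) = ¬? (p ∈? valuationAt s)
    sat? s (θ ∧' θ′) = sat? s θ ×-dec sat? s θ′
    sat? s (θ ∨' θ′) = sat? s θ ⊎-dec sat? s θ′
    sat? s (□ a θ) = All.all? (λ s′ → sat? s′ θ) (class a s)
    sat? s (◇ a θ) = Any.any? (λ s′ → sat? s′ θ) (class a s)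

    module Occupation (M : Model n) where
      open Realisation M
      open Semantics M

      Reaches : ∀ {k U} → Path k U → W M → Set
      Reaches root x = Realises d x T₀
      Reaches (step {k} {U′ = U′} π a _ _) x′ = ∃[ x ] Reaches π x × R M a x x′ × Realises k x′ U′

      reaches-realises : ∀ {k U} (π : Path k U) {x} → Reaches π x → Realises k x U
      reaches-realises root r = r
      reaches-realises (step _ _ _ _) (_ , _ , _ , r) = r

      Occupies : Pos → W M → Set
      Occupies (_ , _ , π) = Reaches π

      rep-occupied : ∀ a s {x} → Occupies s x → ∃[ x₀ ] Occupies (rep a s) x₀ × R M a x₀ x
      rep-occupied a (k , U , root) {x} o = x , o , R-refl a
      rep-occupied a (k , U , step π b m f) {x} o with b ≟ a
      ... | yes refl = let (x₀ , o₀ , r , _) = o in x₀ , o₀ , r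
      ... | no _ = x , o , R-refl a

      members-back : ∀ a r {x₀} → Occupies r x₀ → ∀ {s′} → s′ ∈ members a r →
                     ¬ ¬ (∃[ x′ ] R M a x₀ x′ × Occupies s′ x′)
      members-back a r {x₀} o (here refl) = pure (x₀ , R-refl a , o)
      members-back a (suc k , U , π) {x₀} o (there s′∈) with children-view a π s′∈
      ... | U′ , m , f , refl = do
        (x′ , r , rU′) ← realises-back U a (reaches-realises π o) m
        pure (x′ , r , x₀ , o , r , rU′)

      members-forth : ∀ a {k U} (π : Path (suc k) U) → Fresh a π → ∀ {x₀} → Reaches π x₀ →
                      ∀ {x′} → R M a x₀ x′ → ¬ ¬ (∃[ s′ ] s′ ∈ members a (suc k , U , π) × Occupies s′ x′)
      members-forth a {U = U} π f {x₀} o r = do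
        (U′ , m , rU′) ← realises-forth U a (reaches-realises π o) r
        pure ((_ , U′ , step π a m f) , there (child∈children a π m f) , x₀ , o , r , rU′)

      class-back : ∀ a s {x} → Occupies s x → ∀ {s′} → s′ ∈ class a s →
                   ¬ ¬ (∃[ x′ ] R M a x x′ × Occupies s′ x′)
      class-back a s o s′∈ = do
        let (x₀ , o₀ , r₀) = rep-occupied a s o
        (x′ , r , o′) ← members-back a (rep a s) o₀ s′∈
        pure (x′ , R-trans a (R-sym a r₀) r , o′)

      class-forth : ∀ a s {x} → Occupies s x → 1 ≤ level s → ∀ {x′} → R M a x x′ →
                    ¬ ¬ (∃[ s′ ] s′ ∈ class a s × Occupies s′ x′)
      class-forth a s o l r with rep a s | rep-fresh a s | level-rep a s | rep-occupied a s o
      ... | suc k , U , π | f | _ | x₀ , o₀ , r₀ = members-forth a π f o₀ (R-trans a r₀ r)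
      ... | zero , _ , _ | _ | l′ | _ with ≤-trans l l′
      ...   | ()

      valuation-occupied : ∀ s {x} → Occupies s x → ValuationAt x (valuationAt s)
      valuation-occupied (k , U , π) o = valuation-realised k U (reaches-realises π o)

      ∨-truth : ∀ θ θ′ s {x} → (M , x ⊨ θ) ⇔ Sat s θ → (M , x ⊨ θ′) ⇔ Sat s θ′ →
                (M , x ⊨ (θ ∨' θ′)) ⇔ Sat s (θ ∨' θ′)
      ∨-truth θ θ′ s IH IH′ = mk⇔
        (λ h → decidable-stable (sat? s (θ ∨' θ′)) λ ¬z →
           h ((λ z → ¬z (inj₁ (to IH z))) , (λ z → ¬z (inj₂ (to IH′ z)))))
        λ { (inj₁ z) (¬h , _) → ¬h (from IH z) ; (inj₂ z) (_ , ¬h) → ¬h (from IH′ z) }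

      □-truth : ∀ a θ s {x} → Occupies s x → 1 ≤ level s →
                (∀ {s′ x′} → s′ ∈ class a s → Occupies s′ x′ → (M , x′ ⊨ θ) ⇔ Sat s′ θ) →
                (M , x ⊨ □ a θ) ⇔ Sat s (□ a θ)
      □-truth a θ s o l IH = mk⇔
        (λ h → All.tabulate λ s′∈ → decidable-stable (sat? _ θ) do
           (x′ , r , o′) ← class-back a s o s′∈
           pure (to (IH s′∈ o′) (h x′ r)))
        (λ z x′ r → ⊨-stable θ do
           (s′ , s′∈ , o′) ← class-forth a s o l r
           pure (from (IH s′∈ o′) (All.lookup z s′∈)))

      ◇-truth : ∀ a θ s {x} → Occupies s x → 1 ≤ level s →
                (∀ {s′ x′} → s′ ∈ class a s → Occupies s′ x′ → (M , x′ ⊨ θ) ⇔ Sat s′ θ) →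
                (M , x ⊨ ◇ a θ) ⇔ Sat s (◇ a θ)
      ◇-truth a θ s o l IH = mk⇔
        (λ h → decidable-stable (sat? s (◇ a θ)) λ ¬z → h λ x′ r z →
           class-forth a s o l r λ (s′ , s′∈ , o′) → ¬z (lose s′∈ (to (IH s′∈ o′) z)))
        (λ z k → let (s′ , s′∈ , z′) = find z in
           class-back a s o s′∈ λ (x′ , r , o′) → k x′ r (from (IH s′∈ o′) z′))

      truth : ∀ θ s {x} → Occupies s x → depth θ ≤ level s → θ ⊑ atomsIn P → (M , x ⊨ θ) ⇔ Sat s θ
      truth ⊥' s o _ _ = mk⇔ (λ ()) (λ ())
      truth ⊤' s o _ _ = mk⇔ (λ _ → tt) (λ _ → tt)
      truth (var p) s {x} o _ t = mk⇔ (complete val (var⁺ t here)) (sound val)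
        where
        val : ValuationAt x (valuationAt s)
        val = valuation-occupied s o
      truth (nvar p) s {x} o _ t =
        mk⇔ (λ ¬v p∈ → sound val p∈ ¬v) (λ p∉ v → p∉ (complete val (var⁻ t here) λ ¬v → ¬v v))
        where
        val : ValuationAt x (valuationAt s)
        val = valuation-occupied s o
      truth (θ ∧' θ′) s o dp t = truth θ s o (m⊔n≤o⇒m≤o (depth θ) _ dp) (proj₁ (∧-⊑ t))
                           ×-⇔ truth θ′ s o (m⊔n≤o⇒n≤o (depth θ) _ dp) (proj₂ (∧-⊑ t))
      truth (θ ∨' θ′) s o dp t = ∨-truth θ θ′ s (truth θ s o (m⊔n≤o⇒m≤o (depth θ) _ dp) (proj₁ (∨-⊑ t)))
                                                (truth θ′ s o (m⊔n≤o⇒n≤o (depth θ) _ dp) (proj₂ (∨-⊑ t)))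
      truth (□ a θ) s o dp t = □-truth a θ s o (≤-trans (s≤s z≤n) dp) λ s′∈ o′ →
        truth θ _ o′ (level-in-class a s dp s′∈) (proj₂ (□-⊑ t))
      truth (◇ a θ) s o dp t = ◇-truth a θ s o (≤-trans (s≤s z≤n) dp) λ s′∈ o′ →
        truth θ _ o′ (level-in-class a s dp s′∈) (proj₂ (◇-⊑ t))

    module Characteristic (L : Lang n) (L? : Decides L) where
      open Decides L?

      falsified? : (c : Valuation) → Decidable (λ p → ¬ p ∈ c × Var⁻ L p)
      falsified? c p = ¬? (p ∈? c) ×-dec var⁻? p

      literals : Valuation → Form n
      literals c = ⋀ (map var (filter var⁺? c)) ∧' ⋀ (map nvar (filter (falsified? c) P))

      agents : List (Fin n)
      agents = filter ag? (allFin n)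

      χ : ℕ → Pos → Form n
      moves : ℕ → Pos → Fin n → Form n
      χ zero s = literals (valuationAt s)
      χ (suc k) s = literals (valuationAt s) ∧' ⋀ (map (moves k s) agents)
      moves k s a = ⋀ (map (λ s′ → ◇ a (χ k s′)) (class a s)) ∧' □ a (⋁ (map (χ k) (class a s)))

      literals-⊑ : ∀ c → literals c ⊑ L
      literals-⊑ c = ⊑-∧ (⊑-⋀ (All.map⁺ (All.tabulate λ p∈ → ⊑-var (proj₂ (∈-filter⁻ var⁺? {xs = c} p∈)))))
                         (⊑-⋀ (All.map⁺ (All.tabulate λ p∈ →
                           ⊑-nvar (proj₂ (proj₂ (∈-filter⁻ (falsified? c) {xs = P} p∈))))))

      χ-⊑ : ∀ k s → χ k s ⊑ L
      χ-⊑ zero s = literals-⊑ (valuationAt s)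
      χ-⊑ (suc k) s = ⊑-∧ (literals-⊑ (valuationAt s))
                          (⊑-⋀ (All.map⁺ (All.tabulate λ a∈ → moves-⊑ (proj₂ (∈-filter⁻ ag? {xs = allFin n} a∈)))))
        where
        moves-⊑ : ∀ {a} → Ag L a → moves k s a ⊑ L
        moves-⊑ a = ⊑-∧ (⊑-⋀ (All.map⁺ (All.tabulate λ _ → ⊑-◇ a (χ-⊑ k _))))
                        (⊑-□ a (⊑-⋁ (All.map⁺ (All.tabulate λ _ → χ-⊑ k _))))

      module _ (M : Model n) where
        open Semantics M
        open Realisation M
        open Occupation M

        literals-hold : ∀ {x c} → ValuationAt x c → M , x ⊨ literals c
        literals-hold val =
          ⋀⁺ (All.map⁺ (All.tabulate λ p∈ → sound val (proj₁ (∈-filter⁻ var⁺? p∈)))) ,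
          ⋀⁺ (All.map⁺ (All.tabulate λ p∈ →
            let (p∈P , p∉c , _) = ∈-filter⁻ (falsified? _) p∈ in λ v → p∉c (complete val p∈P λ ¬v → ¬v v)))

        χ-occupied : ∀ k s {x} → Occupies s x → k ≤ level s → M , x ⊨ χ k s
        χ-occupied zero s o _ = literals-hold (valuation-occupied s o)
        χ-occupied (suc k) s {x} o l =
          literals-hold (valuation-occupied s o) , ⋀⁺ (All.map⁺ (All.tabulate λ {a} _ → moves-hold a))
          where
          IH : ∀ {a s′ x′} → s′ ∈ class a s → Occupies s′ x′ → M , x′ ⊨ χ k s′
          IH {a} s′∈ o′ = χ-occupied k _ o′ (level-in-class a s l s′∈)
          moves-hold : ∀ a → M , x ⊨ moves k s a
          moves-hold a =
            ⋀⁺ (All.map⁺ (All.tabulate λ s′∈ k′ →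
              class-back a s o s′∈ λ (x′ , r , o′) → k′ x′ r (IH s′∈ o′))) ,
            λ x′ r → ⊨-stable (⋁ (map (χ k) (class a s))) do
              (s′ , s′∈ , o′) ← class-forth a s o (≤-trans (s≤s z≤n) l) r
              pure (⋁⁺ (Any.map⁺ (lose s′∈ (IH s′∈ o′))))

        literal⁺ : ∀ {y c p} → M , y ⊨ literals c → p ∈ c → Var⁺ L p → M , y ⊨ var p
        literal⁺ (h , _) p∈ v = All.lookup (All.map⁻ (⋀⁻ _ h)) (∈-filter⁺ var⁺? p∈ v)

        literal⁻ : ∀ {y c p} → M , y ⊨ literals c → p ∈ P → ¬ p ∈ c → Var⁻ L p → M , y ⊨ nvar p
        literal⁻ (_ , h) p∈ p∉ v = All.lookup (All.map⁻ (⋀⁻ _ h)) (∈-filter⁺ (falsified? _) p∈ (p∉ , v))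

        χ-literals : ∀ k s {y} → M , y ⊨ χ k s → M , y ⊨ literals (valuationAt s)
        χ-literals zero s h = h
        χ-literals (suc k) s (h , _) = h

        χ-moves : ∀ k s {y a} → M , y ⊨ χ (suc k) s → Ag L a → M , y ⊨ moves k s a
        χ-moves k s {a = a} (_ , h) a∈ = All.lookup (All.map⁻ (⋀⁻ _ h)) (∈-filter⁺ ag? (∈-allFin a) a∈)

        χ-◇ : ∀ k s {y a s′} → M , y ⊨ χ (suc k) s → Ag L a → s′ ∈ class a s →
              ¬ ¬ (∃[ y′ ] R M a y y′ × M , y′ ⊨ χ k s′)
        χ-◇ k s h a∈ s′∈ = ◇⁻ (All.lookup (All.map⁻ (⋀⁻ _ (proj₁ (χ-moves k s h a∈)))) s′∈)

        χ-□ : ∀ k s {y a y′} → M , y ⊨ χ (suc k) s → Ag L a → R M a y y′ →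
              ¬ ¬ (∃[ s′ ] s′ ∈ class a s × M , y′ ⊨ χ k s′)
        χ-□ k s {a = a} {y′} h a∈ r = do
          z ← ⋁⁻ (map (χ k) (class a s)) (proj₂ (χ-moves k s h a∈) y′ r)
          pure (find (Any.map⁻ z))

module Amalgamation {n : ℕ} (φ ψ : Form n) {d : ℕ} (T₀ : Types.Ty n (atoms φ) d) (N : Model n) where
  open Types n (atoms φ)
  open Unravelling T₀
  open Characteristic (lang φ ∩ lang ψ) (lang? φ ∩? lang? ψ)
  open Semantics N

  data Label : Set where
    both : (k : ℕ) (s : Pos) (y : W N) → N , y ⊨ χ k s → Label
    left : ℕ → Pos → Label
    right : ℕ → W N → Label

  tag : Label → ℕ
  tag (both k _ _ _) = k
  tag (left k _) = k
  tag (right k _) = k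

  data PosOf : Label → Pos → Set where
    both : ∀ {k s y h} → PosOf (both k s y h) s
    left : ∀ {k s} → PosOf (left k s) s

  data WorldOf : Label → W N → Set where
    both : ∀ {k s y h} → WorldOf (both k s y h) y
    right : ∀ {k y} → WorldOf (right k y) y

  Edge : Fin n → Label → Label → Set
  Edge a (both _ s y _) (both _ s′ y′ _) = s′ ∈ class a s × R N a y y′
  Edge a (both _ s _ _) (left _ s′) = ¬ a ∈Ag ψ × s′ ∈ class a s
  Edge a (both _ _ y _) (right _ y′) = ¬ a ∈Ag φ × R N a y y′
  Edge a (left _ s) (left _ s′) = s′ ∈ class a s
  Edge a (right _ y) (right _ y′) = R N a y y′
  Edge _ _ _ = ⊥

  Child : Fin n → Label → Label → Set
  Child a ℓ ℓ′ = tag ℓ ≡ suc (tag ℓ′) × Edge a ℓ ℓ′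

  -- On a joint node an atom is true unless it is false at the position and occurs negatively in φ, or
  -- false at the world and occurs positively in ψ; the shared literals of χ make both sides agree.
  Holds : ℕ → Label → Set
  Holds p (both _ s y _) = (p ∈Var⁻ φ → p ∈ valuationAt s) × (p ∈Var⁺ ψ → ¬ ¬ V N p y)
  Holds p (left _ s) = p ∈ valuationAt s
  Holds p (right _ y) = V N p y

  edge-pos-up : ∀ {a ℓc ℓ s} → Edge a ℓc ℓ → PosOf ℓ s → ∃[ sc ] PosOf ℓc sc × s ∈ class a sc
  edge-pos-up {ℓc = both _ _ _ _} (s∈ , _) both = _ , both , s∈
  edge-pos-up {ℓc = both _ _ _ _} (_ , s∈) left = _ , both , s∈
  edge-pos-up {ℓc = left _ _} s∈ left = _ , left , s∈
  edge-pos-up {ℓc = left _ _} () both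
  edge-pos-up {ℓc = right _ _} () both
  edge-pos-up {ℓc = right _ _} () left

  edge-pos-down : ∀ {a ℓc ℓ sc} → a ∈Ag φ → Edge a ℓc ℓ → PosOf ℓc sc → ∃[ s ] PosOf ℓ s × s ∈ class a sc
  edge-pos-down {ℓ = both _ _ _ _} _ (s∈ , _) both = _ , both , s∈
  edge-pos-down {ℓ = left _ _} _ (_ , s∈) both = _ , left , s∈
  edge-pos-down {ℓ = right _ _} a∈ (a∉ , _) both = ⊥-elim (a∉ a∈)
  edge-pos-down {ℓ = left _ _} _ s∈ left = _ , left , s∈
  edge-pos-down {ℓ = both _ _ _ _} _ () left
  edge-pos-down {ℓ = right _ _} _ () left

  edge-world-up : ∀ {a ℓc ℓ y} → Edge a ℓc ℓ → WorldOf ℓ y → ∃[ yc ] WorldOf ℓc yc × R N a yc y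
  edge-world-up {ℓc = both _ _ _ _} (_ , r) both = _ , both , r
  edge-world-up {ℓc = both _ _ _ _} (_ , r) right = _ , both , r
  edge-world-up {ℓc = right _ _} r right = _ , right , r
  edge-world-up {ℓc = left _ _} () both
  edge-world-up {ℓc = left _ _} () right
  edge-world-up {ℓc = right _ _} () both

  edge-world-down : ∀ {a ℓc ℓ yc} → a ∈Ag ψ → Edge a ℓc ℓ → WorldOf ℓc yc → ∃[ y ] WorldOf ℓ y × R N a yc y
  edge-world-down {ℓ = both _ _ _ _} _ (_ , r) both = _ , both , r
  edge-world-down {ℓ = right _ _} _ (_ , r) both = _ , right , r
  edge-world-down {ℓ = left _ _} a∈ (a∉ , _) both = ⊥-elim (a∉ a∈)
  edge-world-down {ℓ = right _ _} _ r right = _ , right , r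
  edge-world-down {ℓ = both _ _ _ _} _ () right
  edge-world-down {ℓ = left _ _} _ () right

  pos-child : ∀ {a ℓc sc s′} → a ∈Ag φ → 1 ≤ tag ℓc → PosOf ℓc sc → s′ ∈ class a sc →
              ¬ ¬ (∃[ ℓ ] Child a ℓc ℓ × PosOf ℓ s′)
  pos-child {ℓc = both (suc k) sc y h} a∈φ _ both s′∈ = do
    yes a∈ψ ← ¬¬-excluded-middle
      where no a∉ψ → pure (left k _ , (refl , a∉ψ , s′∈) , left)
    (y′ , r , h′) ← χ-◇ N k sc h (a∈φ , a∈ψ) s′∈
    pure (both k _ y′ h′ , (refl , s′∈ , r) , both)
  pos-child {ℓc = left (suc k) sc} _ _ left s′∈ = pure (left k _ , (refl , s′∈) , left)

  world-child : ∀ {a ℓc yc y′} → a ∈Ag ψ → 1 ≤ tag ℓc → WorldOf ℓc yc → R N a yc y′ →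
                ¬ ¬ (∃[ ℓ ] Child a ℓc ℓ × WorldOf ℓ y′)
  world-child {ℓc = both (suc k) sc yc h} a∈ψ _ both r = do
    yes a∈φ ← ¬¬-excluded-middle
      where no a∉φ → pure (right k _ , (refl , a∉φ , r) , right)
    (s′ , s′∈ , h′) ← χ-□ N k sc h (a∈φ , a∈ψ) r
    pure (both k s′ _ h′ , (refl , s′∈ , r) , both)
  world-child {ℓc = right (suc k) yc} _ _ right r = pure (right k _ , (refl , r) , right)

  holds-left : ∀ {ℓ s p} → PosOf ℓ s → p ∈Var⁺ φ → p ∈ valuationAt s → Holds p ℓ
  holds-left (both {k} {s} {h = h}) p∈φ p∈ =
    (λ _ → p∈) , λ p∈ψ → literal⁺ N (χ-literals N k s h) p∈ (p∈φ , p∈ψ)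
  holds-left left _ p∈ = p∈

  refutes-left : ∀ {ℓ s p} → PosOf ℓ s → p ∈Var⁻ φ → ¬ p ∈ valuationAt s → ¬ Holds p ℓ
  refutes-left both p∈φ p∉ (holds , _) = p∉ (holds p∈φ)
  refutes-left left _ p∉ = p∉

  holds-right : ∀ {ℓ y p} → WorldOf ℓ y → p ∈Var⁻ ψ → ¬ ¬ V N p y → ¬ ¬ Holds p ℓ
  holds-right {p = p} (both {k} {s} {h = h}) p∈ψ v =
    pure ((λ p∈φ → decidable-stable (p ∈? valuationAt s) λ p∉ →
            v (literal⁻ N (χ-literals N k s h) (var⁻ (⊑-atoms φ) p∈φ) p∉ (p∈φ , p∈ψ))) ,
          λ _ → v)
  holds-right right _ v = v

  refutes-right : ∀ {ℓ y p} → WorldOf ℓ y → p ∈Var⁺ ψ → ¬ V N p y → ¬ Holds p ℓ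
  refutes-right both p∈ψ ¬v (_ , holds) = holds p∈ψ ¬v
  refutes-right right _ ¬v = ¬v

  module Tree {y₀ : W N} (h₀ : N , y₀ ⊨ χ d top) where

    data Node : Set
    label : Node → Label

    data Node where
      origin : Node
      extend : (u : Node) (a : Fin n) (ℓ : Label) → Child a (label u) ℓ → Node

    label origin = both d top y₀ h₀
    label (extend _ _ ℓ _) = ℓ

    anchor : Fin n → Node → Node
    anchor a origin = origin
    anchor a (extend u b ℓ ch) with b ≟ a
    ... | yes _ = u
    ... | no _ = extend u b ℓ ch

    anchor-extend : ∀ {a u ℓ} (ch : Child a (label u) ℓ) → anchor a (extend u a ℓ ch) ≡ u
    anchor-extend {a} ch with a ≟ a
    ... | yes _ = refl
    ... | no a≢a = ⊥-elim (a≢a refl)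

    data Around (a : Fin n) (c : Node) : Node → Set where
      centre : Around a c c
      child : ∀ {ℓ} (ch : Child a (label c) ℓ) → Around a c (extend c a ℓ ch)

    around-anchor : ∀ a u → Around a (anchor a u) u
    around-anchor a origin = centre
    around-anchor a (extend u b ℓ ch) with b ≟ a
    ... | yes refl = child ch
    ... | no _ = centre

    A : Model n
    A = record
      { W = Node
      ; w₀ = origin
      ; R = λ a → _≡_ on anchor a
      ; R-eqv = λ a → On.isEquivalence (anchor a) isEquivalence
      ; V = λ p u → Holds p (label u)
      }

    around-related : ∀ {a} u u′ → R A a u u′ → Around a (anchor a u) u′
    around-related {a} _ u′ e = subst (λ c → Around a c u′) (sym e) (around-anchor a u′)

    tag-around : ∀ {a c u} → Around a c u →
                 tag (label u) ≤ tag (label c) × tag (label c) ≤ suc (tag (label u))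
    tag-around centre = ≤-refl , n≤1+n _
    tag-around (child (e , _)) = ≤-trans (n≤1+n _) (≤-reflexive (sym e)) , ≤-reflexive e

    tag-siblings : ∀ {a c u u′ m} → Around a c u → Around a c u′ →
                   suc m ≤ tag (label u) → m ≤ tag (label u′)
    tag-siblings i i′ lt = ≤-pred (≤-trans lt (≤-trans (proj₁ (tag-around i)) (proj₂ (tag-around i′))))

    tag-anchor : ∀ {a c u m} → Around a c u → suc m ≤ tag (label u) → 1 ≤ tag (label c)
    tag-anchor i lt = ≤-trans (s≤s z≤n) (≤-trans lt (proj₁ (tag-around i)))

    pos-up : ∀ {a c u s} → Around a c u → PosOf (label u) s → ∃[ sc ] PosOf (label c) sc × s ∈ class a sc
    pos-up {a} centre ps = _ , ps , ∈-class a _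
    pos-up (child (_ , e)) ps = edge-pos-up e ps

    pos-down : ∀ {a c u sc} → a ∈Ag φ → Around a c u → PosOf (label c) sc →
               ∃[ s ] PosOf (label u) s × s ∈ class a sc
    pos-down {a} _ centre ps = _ , ps , ∈-class a _
    pos-down a∈ (child (_ , e)) ps = edge-pos-down a∈ e ps

    world-up : ∀ {a c u y} → Around a c u → WorldOf (label u) y → ∃[ yc ] WorldOf (label c) yc × R N a yc y
    world-up {a} centre w = _ , w , R-refl a
    world-up (child (_ , e)) w = edge-world-up e w

    world-down : ∀ {a c u yc} → a ∈Ag ψ → Around a c u → WorldOf (label c) yc →
                 ∃[ y ] WorldOf (label u) y × R N a yc y
    world-down {a} _ centre w = _ , w , R-refl a
    world-down a∈ (child (_ , e)) w = edge-world-down a∈ e w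

    left-preserved : ∀ θ u {s} → PosOf (label u) s → depth θ ≤ tag (label u) → θ ⊑ lang φ →
                     Sat s θ → A , u ⊨ θ
    left-preserved ⊤' _ _ _ _ _ = tt
    left-preserved (var p) _ ps _ t z = pure (holds-left ps (var⁺ t here) z)
    left-preserved (nvar p) _ ps _ t z = refutes-left ps (var⁻ t here) z
    left-preserved (θ ∧' θ′) u ps dp t (z , z′) =
      left-preserved θ u ps (m⊔n≤o⇒m≤o (depth θ) _ dp) (proj₁ (∧-⊑ t)) z ,
      left-preserved θ′ u ps (m⊔n≤o⇒n≤o (depth θ) _ dp) (proj₂ (∧-⊑ t)) z′
    left-preserved (θ ∨' θ′) u ps dp t (inj₁ z) (¬h , _) =
      ¬h (left-preserved θ u ps (m⊔n≤o⇒m≤o (depth θ) _ dp) (proj₁ (∨-⊑ t)) z)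
    left-preserved (θ ∨' θ′) u ps dp t (inj₂ z) (_ , ¬h) =
      ¬h (left-preserved θ′ u ps (m⊔n≤o⇒n≤o (depth θ) _ dp) (proj₂ (∨-⊑ t)) z)
    left-preserved (□ a θ) u ps dp t z u′ r =
      let (sc , psc , s∈) = pos-up (around-anchor a u) ps
          (s′ , ps′ , s′∈) = pos-down (proj₁ (□-⊑ t)) (around-related u u′ r) psc
      in left-preserved θ u′ ps′ (tag-siblings (around-anchor a u) (around-related u u′ r) dp)
           (proj₂ (□-⊑ t))
           (All.lookup z (subst (s′ ∈_) (sym (class-of-member a sc s∈)) s′∈))
    left-preserved (◇ a θ) u ps dp t z k =
      let (s′ , s′∈ , z′) = find z
          (sc , psc , s∈) = pos-up (around-anchor a u) ps
      in pos-child (proj₁ (◇-⊑ t)) (tag-anchor (around-anchor a u) dp) psc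
           (subst (s′ ∈_) (class-of-member a sc s∈) s′∈) λ (ℓ , ch , ps′) →
         k (extend (anchor a u) a ℓ ch) (sym (anchor-extend ch))
           (left-preserved θ _ ps′ (tag-siblings (around-anchor a u) (child ch) dp) (proj₂ (◇-⊑ t)) z′)

    right-preserved : ∀ θ u {y} → WorldOf (label u) y → depth θ ≤ tag (label u) → θ ⊑ dual (lang ψ) →
                      N , y ⊨ θ → A , u ⊨ θ
    right-preserved ⊤' _ _ _ _ _ = tt
    right-preserved (var p) _ w _ t h = holds-right w (var⁺ t here) h
    right-preserved (nvar p) _ w _ t h = refutes-right w (var⁻ t here) h
    right-preserved (θ ∧' θ′) u w dp t (h , h′) =
      right-preserved θ u w (m⊔n≤o⇒m≤o (depth θ) _ dp) (proj₁ (∧-⊑ t)) h ,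
      right-preserved θ′ u w (m⊔n≤o⇒n≤o (depth θ) _ dp) (proj₂ (∧-⊑ t)) h′
    right-preserved (θ ∨' θ′) u w dp t h (¬z , ¬z′) =
      h ((λ z → ¬z (right-preserved θ u w (m⊔n≤o⇒m≤o (depth θ) _ dp) (proj₁ (∨-⊑ t)) z)) ,
         (λ z → ¬z′ (right-preserved θ′ u w (m⊔n≤o⇒n≤o (depth θ) _ dp) (proj₂ (∨-⊑ t)) z)))
    right-preserved (□ a θ) u w dp t h u′ r =
      let (yc , wc , r₁) = world-up (around-anchor a u) w
          (y′ , w′ , r₂) = world-down (proj₁ (□-⊑ t)) (around-related u u′ r) wc
      in right-preserved θ u′ w′ (tag-siblings (around-anchor a u) (around-related u u′ r) dp)
           (proj₂ (□-⊑ t))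
           (h y′ (R-trans a (R-sym a r₁) r₂))
    right-preserved (◇ a θ) u w dp t h k =
      let (yc , wc , r₁) = world-up (around-anchor a u) w in
      ◇⁻ h λ (y′ , r , z) →
      world-child (proj₁ (◇-⊑ t)) (tag-anchor (around-anchor a u) dp) wc (R-trans a r₁ r) λ (ℓ , ch , w′) →
      k (extend (anchor a u) a ℓ ch) (sym (anchor-extend ch))
        (right-preserved θ _ w′ (tag-siblings (around-anchor a u) (child ch) dp) (proj₂ (◇-⊑ t)) z)

  amalgamate : ∀ {y₀} → N , y₀ ⊨ χ d top → depth φ ≤ d → depth ψ ≤ d → Sat top φ → N , y₀ ⊨ ∼ ψ →
               Σ (Model n) λ A → Σ (W A) λ w → (A , w ⊨ φ) × (A , w ⊨ ∼ ψ)
  amalgamate h₀ dφ dψ zφ h∼ψ =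
    A , origin , left-preserved φ origin both dφ (⊑-lang φ) zφ ,
    right-preserved (∼ ψ) origin both (≤-trans (≤-reflexive (depth-∼ ψ)) dψ) (∼-⊑-dual ψ) h∼ψ
    where open Tree h₀

module Interpolant {n : ℕ} (φ ψ : Form n) where
  open Types n (atoms φ)

  d : ℕ
  d = depth φ ⊔ depth ψ

  shared : Lang n
  shared = lang φ ∩ lang ψ

  module U (T₀ : Ty d) = Unravelling T₀
  module C (T₀ : Ty d) = U.Characteristic T₀ shared (lang? φ ∩? lang? ψ)

  φ-at-top? : Decidable λ T₀ → U.Sat T₀ (U.top T₀) φ
  φ-at-top? T₀ = U.sat? T₀ (U.top T₀) φ

  χ-top : Ty d → Form n
  χ-top T₀ = C.χ T₀ d (U.top T₀)

  δ : Form n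
  δ = ⋁ (map χ-top (filter φ-at-top? (types d)))

  δ-⊑ : δ ⊑ shared
  δ-⊑ = ⊑-⋁ (All.map⁺ (All.tabulate λ {T₀} _ → C.χ-⊑ T₀ d (U.top T₀)))

  δ-realised : ∀ M w → M , w ⊨ φ → (∃[ T₀ ] T₀ ∈ types d × Realisation.Realises M d w T₀) → M , w ⊨ δ
  δ-realised M w hφ (T₀ , T₀∈ , r) =
    ⋁⁺ (Any.map⁺ (lose (∈-filter⁺ φ-at-top? T₀∈ φ-at-top) (χ-occupied M d top r ≤-refl)))
    where
    open Semantics M
    open U T₀
    open Occupation M
    open C T₀
    φ-at-top : Sat top φ
    φ-at-top = to (truth φ top r (m≤m⊔n (depth φ) _) (⊑-atoms φ)) hφ

  φ⇒δ : S5 n (φ ⇒ δ)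
  φ⇒δ = ⇒-valid λ M w hφ → ¬¬-map (δ-realised M w hφ) (Realisation.realise M d w)

  δ⇒ψ : S5 n (φ ⇒ ψ) → S5 n (δ ⇒ ψ)
  δ⇒ψ valid = ⇒-valid λ N v hδ ¬hψ → ⋁⁻ N _ hδ λ hχ →
    let (T₀ , T₀∈ , hχ-top) = find (Any.map⁻ hχ)
        (A , w , hφ , h∼ψ) = Amalgamation.amalgamate φ ψ T₀ N hχ-top (m≤m⊔n (depth φ) _) (m≤n⊔m _ (depth ψ))
                               (proj₂ (∈-filter⁻ φ-at-top? {xs = types d} T₀∈)) (∼-intro N ψ ¬hψ)
    in ⇒-refutes valid A w hφ h∼ψ
    where open Semantics

corollary3 : (m : ℕ) → (φ ψ : Form (suc m)) → S5 (suc m) (φ ⇒ ψ) →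
    Σ (Form (suc m)) λ δ →
      S5 (suc m) (φ ⇒ δ) × S5 (suc m) (δ ⇒ ψ)
      × ((p : ℕ) → p ∈Var⁺ δ → (p ∈Var⁺ φ) × (p ∈Var⁺ ψ))
      × ((p : ℕ) → p ∈Var⁻ δ → (p ∈Var⁻ φ) × (p ∈Var⁻ ψ))
      × ((a : Fin (suc m)) → a ∈Ag δ → (a ∈Ag φ) × (a ∈Ag ψ))
corollary3 m φ ψ valid = δ , φ⇒δ , δ⇒ψ valid , (λ _ → var⁺ δ-⊑) , (λ _ → var⁻ δ-⊑) , (λ _ → ag δ-⊑)
  where open Interpolant φ ψ
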